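{- For any graph $G$ and any graph $H$ with root $v\in V(H)$, $$\chi_i(G\circ_v H)\in\{\chi_i(G),\ \chi_i(H),\ \chi_i(G)+1,\ \chi_i(H)+1,\ \Delta(G)+d_H(v),\ \Delta(G)+d_H(v)+1\}.$$
   Context: An injective $k$-coloring of a graph is a map $f:V\to\{1,\dots,k\}$ such that no vertex has two neighbors $u\neq w$ with $f(u)=f(w)$; $\chi_i$ denotes the least such $k$. For a graph $G$ with $V(G)=\{v_1,\ldots,v_n\}$ and a graph $H$ with root $v$, the rooted product $G\circ_v H$ has vertex set $V(G)\times V(H)$ and edge set $\bigcup_{i=1}^n\{(v_i,h)(v_i,h') : hh'\in E(H)\}\cup\{(v_i,v)(v_j,v): v_iv_j\in E(G)\}$ (i.e., a copy of $H$ is attached to each vertex $v_i$ of $G$ by identifying its root with $v_i$). $\Delta(G)$ is the maximum degree of $G$ and $d_H(v)$ the degree of $v$ in $H$. -}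

module Defs where

open import Data.Nat using (ℕ; suc; _+_; _⊔_; _≤_)
open import Data.Fin using (Fin; remQuot)
open import Data.Fin.Properties using () renaming (_≟_ to _≟ᶠ_)
open import Data.Bool using (Bool; true; false; _∧_; _∨_; if_then_else_)
open import Data.List using (List; map; foldr; allFin)
open import Data.Nat.ListAction using (sum)
open import Data.Product using (Σ; _×_; _,_; proj₁; proj₂)
open import Relation.Nullary.Decidable using (⌊_⌋)
open import Relation.Binary.PropositionalEquality using (_≡_)

record Graph : Set where
  constructor mkGraph
  field
    n   : ℕ
    adj : Fin n → Fin n → Bool
open Graph public

IsSimple : Graph → Set
IsSimple G = ((x y : Fin (n G)) → adj G x y ≡ adj G y x)
           × ((x : Fin (n G)) → adj G x x ≡ false)

IsInjectiveColoring : (G : Graph) (k : ℕ) → (Fin (n G) → Fin k) → Set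
IsInjectiveColoring G k f =
  (x u w : Fin (n G)) → adj G x u ≡ true → adj G x w ≡ true → f u ≡ f w → u ≡ w

HasInjectiveColoring : Graph → ℕ → Set
HasInjectiveColoring G k = Σ (Fin (n G) → Fin k) (IsInjectiveColoring G k)

InjChromaticNumber : Graph → ℕ → Set
InjChromaticNumber G k =
  HasInjectiveColoring G k × ((k' : ℕ) → HasInjectiveColoring G k' → k ≤ k')

degree : (G : Graph) → Fin (n G) → ℕ
degree G x = sum (map (λ u → if adj G x u then 1 else 0) (allFin (n G)))

maxDegree : Graph → ℕ
maxDegree G = foldr _⊔_ 0 (map (degree G) (allFin (n G)))

-- Rooted product G ∘_r H.  Vertex (v_i , h) is encoded as an element of
-- Fin (n G * n H) via Data.Fin.remQuot / combine.
rootedProduct : (G H : Graph) → Fin (n H) → Graph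
rootedProduct G H r = mkGraph (n G Data.Nat.* n H) A
  where
  A : Fin (n G Data.Nat.* n H) → Fin (n G Data.Nat.* n H) → Bool
  A x y with remQuot (n H) x | remQuot (n H) y
  ... | (i , h) | (j , h') =
        (⌊ i ≟ᶠ j ⌋ ∧ adj H h h')
      ∨ (⌊ h ≟ᶠ r ⌋ ∧ ⌊ h' ≟ᶠ r ⌋ ∧ adj G i j)

module Submission where

-- Let M = max(χᵢ(G), χᵢ(H), Δ(G) + d_H(r)); we show M ≤ χᵢ(G ∘ᵣ H) ≤ M + 1.
-- Lower bound: an injective coloring of the product restricts to injective colorings of G (on the
-- roots) and of H (on any copy), and the d_G(i) + d_H(r) neighbours of a root (i , r) must receive
-- pairwise distinct colors.
-- Upper bound: with M + 1 colors, give root i the color f(i) of an injective coloring f of G and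
-- the rest of copy i the colors σᵢ ∘ g, where g is an injective coloring of H and σᵢ is an injection
-- of its colors that avoids f(i) and sends the colors g uses around r outside the at most Δ(G) + 1
-- colors f uses on i and its neighbours.  Such a σᵢ exists by counting, as M + 1 − (Δ(G) + 1) ≥ d_H(r)
-- and M ≥ χᵢ(H).

open import Defs
open import Data.Bool using (Bool; true; false; _∧_; _∨_; not; if_then_else_)
open import Data.Bool.Properties using (∧-conicalˡ; ∧-conicalʳ; ∨-zeroʳ; not-¬)
open import Data.Nat using (ℕ; zero; suc; pred; _+_; _*_; _⊔_; _≤_; _<_; z≤n; s≤s; s≤s⁻¹; _<?_)
open import Data.Nat.Properties
  using ( ≤-refl; ≤-reflexive; ≤-trans; ≤-<-trans; <⇒≤; ≤-antisym; ≮⇒≥; n≤0⇒n≡0; m≤n⇒m≤1+n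
        ; m≤n⇒m<n∨m≡n; +-comm; +-suc; m≤m+n; m≤n+m; +-mono-≤; +-monoʳ-≤; +-monoˡ-≤; +-cancelˡ-≤
        ; ⊔-sel; ⊔-lub; m≤m⊔n; m≤n⊔m; m≤n⇒m≤n⊔o; m≤n⇒m≤o⊔n; module ≤-Reasoning )
open import Data.Nat.ListAction using (sum)
open import Data.Fin using (Fin; zero; suc; remQuot; combine; inject≤)
open import Data.Fin.Properties
  using (_≟_; 0≢1+n; suc-injective; remQuot-combine; combine-remQuot; combine-injective; inject≤-injective)
open import Data.Product using (∃; _×_; _,_; proj₁; proj₂; uncurry)
open import Data.Product.Properties using (×-≡,≡→≡)
open import Data.Sum using (_⊎_; inj₁; inj₂; [_,_]′)
open import Data.List using (map; allFin; tabulate; _∷_; [])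
open import Data.List.Properties using (map-tabulate; foldr-preservesᵒ)
open import Data.List.Relation.Unary.Any using (here; there)
import Data.List.Relation.Unary.Any.Properties as Any
open import Data.List.Membership.Propositional using (_∈_; lose)
open import Data.List.Membership.Propositional.Properties using (∈-allFin; ∈-map⁻; foldr-selective)
open import Data.Vec.Functional using () renaming (_∷_ to _◂_)
open import Function using (_∘_; id)
open import Function.Definitions using (Injective)
open import Relation.Nullary using (yes; no; contradiction)
open import Relation.Nullary.Decidable using (⌊_⌋; ⌊⌋-map′)
open import Relation.Binary.PropositionalEquality

private
  variable
    a b k m : ℕ
    A : Set

infixr 7 _∩_
infixr 6 _∪_
infixl 5 _-_
infix 4 _⊆_

_∩_ _∪_ : (Fin m → Bool) → (Fin m → Bool) → Fin m → Bool
(p ∩ q) x = p x ∧ q x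
(p ∪ q) x = p x ∨ q x

∁ : (Fin m → Bool) → Fin m → Bool
∁ p x = not (p x)

⁅_⁆ : Fin m → Fin m → Bool
⁅ y ⁆ x = ⌊ x ≟ y ⌋

_-_ : (Fin m → Bool) → Fin m → Fin m → Bool
p - y = p ∩ ∁ ⁅ y ⁆

_⊆_ : (Fin m → Bool) → (Fin m → Bool) → Set
p ⊆ q = ∀ x → p x ≡ true → q x ≡ true

InjectiveOn : (Fin m → Bool) → (Fin m → A) → Set
InjectiveOn p f = ∀ x y → p x ≡ true → p y ≡ true → f x ≡ f y → x ≡ y

any : (Fin m → Bool) → Bool
any {zero}  p = false
any {suc m} p = p zero ∨ any (p ∘ suc)

image : (Fin a → Bool) → (Fin a → Fin b) → Fin b → Bool
image p f y = any (λ x → p x ∧ ⌊ y ≟ f x ⌋)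

count : (Fin m → Bool) → ℕ
count {zero}  p = 0
count {suc m} p = (if p zero then 1 else 0) + count (p ∘ suc)

⁅⁆-refl : (y : Fin m) → ⁅ y ⁆ y ≡ true
⁅⁆-refl y with y ≟ y
... | yes _  = refl
... | no y≢y = contradiction refl y≢y

⁅⁆⇒≡ : {x y : Fin m} → ⁅ y ⁆ x ≡ true → x ≡ y
⁅⁆⇒≡ {x = x} {y} e with x ≟ y
... | yes x≡y = x≡y

≢⇒∉⁅⁆ : {x y : Fin m} → x ≢ y → ⁅ y ⁆ x ≡ false
≢⇒∉⁅⁆ {x = x} {y} x≢y with x ≟ y
... | yes x≡y = contradiction x≡y x≢y
... | no _    = refl

delete⁺ : (p : Fin m → Bool) {x y : Fin m} → p x ≡ true → x ≢ y → (p - y) x ≡ true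
delete⁺ p px x≢y rewrite px | ≢⇒∉⁅⁆ x≢y = refl

∁⁅⁆⇒≢ : {x y : Fin m} → ∁ ⁅ y ⁆ x ≡ true → x ≢ y
∁⁅⁆⇒≢ {x = x} e refl with () ← trans (cong not (sym (⁅⁆-refl x))) e

delete⁻ : (p : Fin m → Bool) {x y : Fin m} → (p - y) x ≡ true → p x ≡ true × x ≢ y
delete⁻ p {x} e = ∧-conicalˡ (p x) _ e , ∁⁅⁆⇒≢ (∧-conicalʳ (p x) _ e)

p⊆p∪q : {p : Fin m → Bool} (q : Fin m → Bool) → p ⊆ p ∪ q
p⊆p∪q q x px = cong (_∨ q x) px

q⊆p∪q : (p : Fin m → Bool) {q : Fin m → Bool} → q ⊆ p ∪ q
q⊆p∪q p x qx = trans (cong (p x ∨_) qx) (∨-zeroʳ (p x))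

∁-anti : {p q : Fin m → Bool} → p ⊆ q → ∁ q ⊆ ∁ p
∁-anti {p = p} p⊆q x e with p x in px
... | false = refl
... | true with () ← trans (cong not (sym (p⊆q x px))) e

image⁺ : {p : Fin a → Bool} (f : Fin a → Fin b) {x : Fin a} → p x ≡ true → image p f (f x) ≡ true
image⁺ f {zero} px rewrite px | ⁅⁆-refl (f zero) = refl
image⁺ {p = p} f {suc x} px with p zero ∧ ⌊ f (suc x) ≟ f zero ⌋
... | true  = refl
... | false = image⁺ (f ∘ suc) px

image⁻ : {p : Fin a → Bool} (f : Fin a → Fin b) {y : Fin b} → image p f y ≡ true →
         ∃ λ x → p x ≡ true × y ≡ f x
image⁻ {suc a} {p = p} f {y} e with p zero in p0 | y ≟ f zero
... | true  | yes y≡f0 = zero , p0 , y≡f0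
... | true  | no _     = let x , px , y≡fx = image⁻ (f ∘ suc) e in suc x , px , y≡fx
... | false | _        = let x , px , y≡fx = image⁻ (f ∘ suc) e in suc x , px , y≡fx

count-cong : {p q : Fin m → Bool} → (∀ x → p x ≡ q x) → count p ≡ count q
count-cong {zero}  p≗q = refl
count-cong {suc m} p≗q = cong₂ _+_ (cong (if_then 1 else 0) (p≗q zero)) (count-cong (p≗q ∘ suc))

count-none : count {m} (λ _ → false) ≡ 0
count-none {zero}  = refl
count-none {suc m} = count-none {m}

count-all : count {m} (λ _ → true) ≡ m
count-all {zero}  = refl
count-all {suc m} = cong suc (count-all {m})

count-split : (p q : Fin m → Bool) → count p ≡ count (p ∩ q) + count (p ∩ ∁ q)
count-split {zero}  p q = refl
count-split {suc m} p q with p zero | q zero | count-split (p ∘ suc) (q ∘ suc)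
... | false | _     | ih = ih
... | true  | true  | ih = cong suc ih
... | true  | false | ih = trans (cong suc ih) (sym (+-suc _ _))

count-complement : (p : Fin m → Bool) → count p + count (∁ p) ≡ m
count-complement p = trans (sym (count-split (λ _ → true) p)) count-all

count≤size : (p : Fin m → Bool) → count p ≤ m
count≤size p = ≤-trans (m≤m+n _ _) (≤-reflexive (count-complement p))

count-mono : {p q : Fin m → Bool} → p ⊆ q → count p ≤ count q
count-mono {zero}          p⊆q = z≤n
count-mono {suc m} {p} {q} p⊆q with p zero in p0 | q zero in q0
... | false | false = count-mono (p⊆q ∘ suc)
... | false | true  = ≤-trans (count-mono (p⊆q ∘ suc)) (m≤n+m _ 1)
... | true  | true  = s≤s (count-mono (p⊆q ∘ suc))
... | true  | false with () ← trans (sym (p⊆q zero p0)) q0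

count-⁅⁆ : (y : Fin m) → count ⁅ y ⁆ ≡ 1
count-⁅⁆ {suc m} zero = cong suc (count-none {m})
count-⁅⁆ (suc y)       = trans (count-cong (λ x → ⌊⌋-map′ (cong suc) suc-injective (x ≟ y))) (count-⁅⁆ y)

count-∁⁅⁆ : (y : Fin (suc m)) → count (∁ ⁅ y ⁆) ≡ m
count-∁⁅⁆ y = cong pred (trans (cong (_+ count (∁ ⁅ y ⁆)) (sym (count-⁅⁆ y))) (count-complement ⁅ y ⁆))

count-delete : (p : Fin m → Bool) {y : Fin m} → p y ≡ true → suc (count (p - y)) ≡ count p
count-delete p {y} py = begin
  suc (count (p - y))                ≡⟨ cong (_+ count (p - y)) (sym p∩⁅y⁆≡1) ⟩
  count (p ∩ ⁅ y ⁆) + count (p - y)  ≡⟨ sym (count-split p ⁅ y ⁆) ⟩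
  count p                            ∎
  where
  open ≡-Reasoning
  p∩⁅y⁆≡1 : count (p ∩ ⁅ y ⁆) ≡ 1
  p∩⁅y⁆≡1 = trans
    (≤-antisym (count-mono {q = ⁅ y ⁆} (λ x e → ∧-conicalʳ (p x) _ e))
               (count-mono {p = ⁅ y ⁆} (λ x e → subst (λ z → (p ∩ ⁅ y ⁆) z ≡ true) (sym (⁅⁆⇒≡ e))
                                          (cong₂ _∧_ py (⁅⁆-refl y)))))
    (count-⁅⁆ y)

0<count⇒∃ : (p : Fin m → Bool) → 0 < count p → ∃ λ x → p x ≡ true
0<count⇒∃ {suc m} p 0<count with p zero in p0
... | true  = zero , p0
... | false = let x , px = 0<count⇒∃ (p ∘ suc) 0<count in suc x , px

count-∪ : (p q : Fin m → Bool) → count (p ∪ q) ≤ count p + count q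
count-∪ p q = begin
  count (p ∪ q)                                ≡⟨ count-split (p ∪ q) p ⟩
  count ((p ∪ q) ∩ p) + count ((p ∪ q) ∩ ∁ p)  ≤⟨ +-mono-≤ (count-mono (λ x → ∧-conicalʳ _ (p x)))
                                                           (count-mono (λ x → onlyRight (p x))) ⟩
  count p + count q                            ∎
  where
  open ≤-Reasoning
  onlyRight : ∀ a {b} → (a ∨ b) ∧ not a ≡ true → b ≡ true
  onlyRight false e = ∧-conicalˡ _ true e

count-injective-≤ : {p : Fin a → Bool} {q : Fin b → Bool} (f : Fin a → Fin b) →
                    p ⊆ q ∘ f → InjectiveOn p f → count p ≤ count q
count-injective-≤ {zero}  f p⊆qf inj = z≤n
count-injective-≤ {suc a} {p = p} {q} f p⊆qf inj with p zero in p0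
... | false = count-injective-≤ (f ∘ suc) (p⊆qf ∘ suc) inj′
  where inj′ = λ x y px py e → suc-injective (inj (suc x) (suc y) px py e)
... | true = begin
  suc (count (p ∘ suc))     ≤⟨ s≤s (count-injective-≤ {q = q - f zero} (f ∘ suc) into inj′) ⟩
  suc (count (q - f zero))  ≡⟨ count-delete q (p⊆qf zero p0) ⟩
  count q                   ∎
  where
  open ≤-Reasoning
  inj′ = λ x y px py e → suc-injective (inj (suc x) (suc y) px py e)
  into : p ∘ suc ⊆ (q - f zero) ∘ f ∘ suc
  into x px = delete⁺ q (p⊆qf (suc x) px) (λ e → 0≢1+n (inj zero (suc x) p0 px (sym e)))

count-image-≤ : (p : Fin a → Bool) (f : Fin a → Fin b) → count (image p f) ≤ count p
count-image-≤ {zero} {b} p f = ≤-reflexive (count-none {b})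
count-image-≤ {suc a} {b} p f = begin
  count (image p f)                                ≤⟨ count-∪ image₀ (image (p ∘ suc) (f ∘ suc)) ⟩
  count image₀ + count (image (p ∘ suc) (f ∘ suc)) ≤⟨ +-mono-≤ count-image₀ (count-image-≤ (p ∘ suc) (f ∘ suc)) ⟩
  (if p zero then 1 else 0) + count (p ∘ suc)      ∎
  where
  open ≤-Reasoning
  image₀ : Fin b → Bool
  image₀ y = p zero ∧ ⁅ f zero ⁆ y
  count-image₀ : count image₀ ≤ (if p zero then 1 else 0)
  count-image₀ with p zero
  ... | true  = ≤-reflexive (count-⁅⁆ (f zero))
  ... | false = ≤-reflexive (count-none {b})

count+count≤ : {p : Fin a → Bool} {q : Fin b → Bool} (f : Fin a → Fin k) (g : Fin b → Fin k) →
  InjectiveOn p f → InjectiveOn q g → (∀ x y → p x ≡ true → q y ≡ true → f x ≢ g y) →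
  count p + count q ≤ k
count+count≤ {k = k} {p = p} {q} f g f-inj g-inj apart = begin
  count p + count q                          ≤⟨ +-mono-≤ (count-injective-≤ f (λ _ → image⁺ f) f-inj)
                                                         (count-injective-≤ g outside g-inj) ⟩
  count (image p f) + count (∁ (image p f))  ≡⟨ count-complement (image p f) ⟩
  k                                          ∎
  where
  open ≤-Reasoning
  outside : q ⊆ ∁ (image p f) ∘ g
  outside y qy with image p f (g y) in hit
  ... | false = refl
  ... | true  = let x , px , gy≡fx = image⁻ f hit in contradiction (sym gy≡fx) (apart x y px qy)

count<⇒∃ : {p q : Fin m → Bool} → count p < count q → ∃ λ x → q x ≡ true × p x ≡ false
count<⇒∃ {suc m} {p} {q} p<q with p zero in p0 | q zero in q0
... | false | true  = zero , q0 , p0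
... | false | false = let x , qx , px = count<⇒∃ p<q in suc x , qx , px
... | true  | true  = let x , qx , px = count<⇒∃ (s≤s⁻¹ p<q) in suc x , qx , px
... | true  | false = let x , qx , px = count<⇒∃ (<⇒≤ p<q) in suc x , qx , px

count-delete-< : (p : Fin m → Bool) {y : Fin m} {j : ℕ} → p y ≡ true → j < count p → j ≤ count (p - y)
count-delete-< p py j<p = s≤s⁻¹ (subst (_ <_) (sym (count-delete p py)) j<p)

record RespectfulInjection (P : Fin a → Bool) (Q R : Fin b → Bool) : Set where
  field
    σ         : Fin a → Fin b
    injective : Injective _≡_ _≡_ σ
    into      : ∀ x → R (σ x) ≡ true
    respects  : P ⊆ Q ∘ σ

delete-mono : {p q : Fin m → Bool} {y : Fin m} → p ⊆ q → p - y ⊆ q - y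
delete-mono {p = p} {q} p⊆q x e = let px , x≢y = delete⁻ p e in delete⁺ q (p⊆q x px) x≢y

count-∉-delete : (p : Fin m → Bool) {y : Fin m} → p y ≡ false → count p ≤ count (p - y)
count-∉-delete p {y} py = count-mono {q = p - y} λ x px → delete⁺ p px (λ { refl → not-¬ px py })

respectfulInjection-cons : {P : Fin (suc a) → Bool} {Q R : Fin b → Bool} {y : Fin b} →
  R y ≡ true → (P zero ≡ true → Q y ≡ true) →
  RespectfulInjection (P ∘ suc) (Q - y) (R - y) → RespectfulInjection P Q R
respectfulInjection-cons {P = P} {Q} {R} {y} Ry Qy ι = record
  { σ = y ◂ σ ; injective = injective′ ; into = into′ ; respects = respects′ }
  where
  open RespectfulInjection ι
  σ≢y : ∀ x → σ x ≢ y
  σ≢y x = proj₂ (delete⁻ R (into x))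
  injective′ : Injective _≡_ _≡_ (y ◂ σ)
  injective′ {zero}  {zero}  _ = refl
  injective′ {zero}  {suc x} e = contradiction (sym e) (σ≢y x)
  injective′ {suc x} {zero}  e = contradiction e (σ≢y x)
  injective′ {suc x} {suc _} e = cong suc (injective e)
  into′ : ∀ x → R ((y ◂ σ) x) ≡ true
  into′ zero    = Ry
  into′ (suc x) = proj₁ (delete⁻ R (into x))
  respects′ : P ⊆ Q ∘ (y ◂ σ)
  respects′ zero    = Qy
  respects′ (suc x) = proj₁ ∘ delete⁻ Q ∘ respects x

-- Greedily: send 0 into Q while Q has more room than the rest of P needs, otherwise to a point of
-- R outside Q, which exists since count Q ≤ count (P ∘ suc) < a ≤ count R.
respectfulInjection : {P : Fin a → Bool} {Q R : Fin b → Bool} →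
  Q ⊆ R → count P ≤ count Q → a ≤ count R → RespectfulInjection P Q R
respectfulInjection {zero} _ _ _ =
  record { σ = λ () ; injective = λ { {()} } ; into = λ () ; respects = λ () }
respectfulInjection {suc a} {P = P} {Q} {R} Q⊆R P≤Q a<R with count (P ∘ suc) <? count Q
... | yes P′<Q with 0<count⇒∃ Q (≤-trans (s≤s z≤n) P′<Q)
...   | y , Qy = respectfulInjection-cons (Q⊆R y Qy) (λ _ → Qy)
                   (respectfulInjection (delete-mono Q⊆R) (count-delete-< Q Qy P′<Q)
                                        (count-delete-< R (Q⊆R y Qy) a<R))
respectfulInjection {suc a} {P = P} {Q} {R} Q⊆R P≤Q a<R | no P′≮Q with P zero in P0
... | true  = contradiction P≤Q P′≮Q
... | false with count<⇒∃ {p = Q} {q = R} (≤-<-trans (≮⇒≥ P′≮Q) (≤-<-trans (count≤size (P ∘ suc)) a<R))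
...   | y , Ry , Qy = respectfulInjection-cons Ry (λ P0′ → contradiction P0 (not-¬ P0′))
                        (respectfulInjection (delete-mono Q⊆R) (≤-trans P≤Q (count-∉-delete Q Qy))
                                             (count-delete-< R Ry a<R))

sum-indicator≡count : (p : Fin m → Bool) → sum (tabulate (λ x → if p x then 1 else 0)) ≡ count p
sum-indicator≡count {zero}  p = refl
sum-indicator≡count {suc m} p = cong ((if p zero then 1 else 0) +_) (sum-indicator≡count (p ∘ suc))

degree≡count : (G : Graph) (x : Fin (n G)) → degree G x ≡ count (adj G x)
degree≡count G x = trans (cong sum (map-tabulate id (λ u → if adj G x u then 1 else 0))) (sum-indicator≡count (adj G x))

degree≤maxDegree : (G : Graph) (x : Fin (n G)) → degree G x ≤ maxDegree G
degree≤maxDegree G x = foldr-preservesᵒ {P = degree G x ≤_} (λ u v → [ m≤n⇒m≤n⊔o v , m≤n⇒m≤o⊔n u ]′) 0 _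
  (inj₂ (Any.map⁺ (lose {P = λ y → degree G x ≤ degree G y} (∈-allFin x) ≤-refl)))

maxDegree-attained : (G : Graph) → Fin (n G) → ∃ λ x → maxDegree G ≡ degree G x
maxDegree-attained G x₀ with foldr-selective ⊔-sel 0 (map (degree G) (allFin (n G)))
... | inj₁ Δ≡0 = x₀ , trans Δ≡0 (sym (n≤0⇒n≡0 (subst (degree G x₀ ≤_) Δ≡0 (degree≤maxDegree G x₀))))
... | inj₂ Δ∈  = let x , _ , Δ≡dx = ∈-map⁻ (degree G) Δ∈ in x , Δ≡dx

module RootedProduct (G H : Graph) (r : Fin (n H)) where

  Vertex : Set
  Vertex = Fin (n G) × Fin (n H)

  data Edge : Vertex → Vertex → Set where
    inCopy     : {i : Fin (n G)} {h h′ : Fin (n H)} → adj H h h′ ≡ true → Edge (i , h) (i , h′)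
    alongRoots : {i j : Fin (n G)} → adj G i j ≡ true → Edge (i , r) (j , r)

  -- Definitionally, adj (rootedProduct G H r) x y is rootedAdj (remQuot (n H) x) (remQuot (n H) y).
  rootedAdj : Vertex → Vertex → Bool
  rootedAdj (i , h) (j , h′) = (⌊ i ≟ j ⌋ ∧ adj H h h′) ∨ (⌊ h ≟ r ⌋ ∧ ⌊ h′ ≟ r ⌋ ∧ adj G i j)

  rootedAdj⇒Edge : {p q : Vertex} → rootedAdj p q ≡ true → Edge p q
  rootedAdj⇒Edge {i , h} {j , h′} e with i ≟ j | h ≟ r | h′ ≟ r | adj H h h′ in hh′
  ... | yes refl | _        | _        | true  = inCopy hh′
  ... | yes refl | yes refl | yes refl | false = alongRoots e
  ... | no _     | yes refl | yes refl | _     = alongRoots e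

  Edge⇒rootedAdj : {p q : Vertex} → Edge p q → rootedAdj p q ≡ true
  Edge⇒rootedAdj (inCopy {i} hh′) rewrite ⁅⁆-refl i | hh′ = refl
  Edge⇒rootedAdj (alongRoots ij) rewrite ⁅⁆-refl r | ij = ∨-zeroʳ _

  adj⇒Edge : {x y : Fin (n G * n H)} → adj (rootedProduct G H r) x y ≡ true →
             Edge (remQuot (n H) x) (remQuot (n H) y)
  adj⇒Edge = rootedAdj⇒Edge

  Edge⇒adj : {p q : Vertex} → Edge p q →
             adj (rootedProduct G H r) (uncurry combine p) (uncurry combine q) ≡ true
  Edge⇒adj {i , h} {j , h′} e = trans (cong₂ rootedAdj (remQuot-combine i h) (remQuot-combine j h′))
                                      (Edge⇒rootedAdj e)

  IsInjectiveColoringᴱ : (k : ℕ) → (Vertex → Fin k) → Set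
  IsInjectiveColoringᴱ k c = ∀ {p q s} → Edge p q → Edge p s → c q ≡ c s → q ≡ s

  fromPairs : {c : Vertex → Fin k} → IsInjectiveColoringᴱ k c →
              IsInjectiveColoring (rootedProduct G H r) k (c ∘ remQuot (n H))
  fromPairs inj x u w xu xw cu≡cw = begin
    u                                       ≡⟨ combine-remQuot {n G} (n H) u ⟨
    uncurry combine (remQuot {n G} (n H) u) ≡⟨ cong (uncurry combine) (inj (adj⇒Edge xu) (adj⇒Edge xw) cu≡cw) ⟩
    uncurry combine (remQuot {n G} (n H) w) ≡⟨ combine-remQuot {n G} (n H) w ⟩
    w                                       ∎
    where open ≡-Reasoning

  toPairs : {c : Fin (n G * n H) → Fin k} → IsInjectiveColoring (rootedProduct G H r) k c →
            IsInjectiveColoringᴱ k (c ∘ uncurry combine)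
  toPairs inj {i , h} {j , h′} {l , h″} pq ps cq≡cs =
    ×-≡,≡→≡ (combine-injective j h′ l h″ (inj (combine i h) _ _ (Edge⇒adj pq) (Edge⇒adj ps) cq≡cs))

  module _ {c : Vertex → Fin k} (inj : IsInjectiveColoringᴱ k c) where

    restrictToRoots : IsInjectiveColoring G k (λ i → c (i , r))
    restrictToRoots _ _ _ xu xw = cong proj₁ ∘ inj (alongRoots xu) (alongRoots xw)

    restrictToCopy : (i : Fin (n G)) → IsInjectiveColoring H k (λ h → c (i , h))
    restrictToCopy i _ _ _ xu xw = cong proj₂ ∘ inj (inCopy xu) (inCopy xw)

    degree+degree≤ : adj H r r ≡ false → (i : Fin (n G)) → degree G i + degree H r ≤ k
    degree+degree≤ loopless i =
      subst₂ (λ d d′ → d + d′ ≤ k) (sym (degree≡count G i)) (sym (degree≡count H r))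
        (count+count≤ (λ j → c (j , r)) (λ h → c (i , h)) (restrictToRoots i) (restrictToCopy i r) apart)
      where
      apart : ∀ j h → adj G i j ≡ true → adj H r h ≡ true → c (j , r) ≢ c (i , h)
      apart j h ij rh eq with refl ← cong proj₂ (inj (alongRoots ij) (inCopy rh) eq) =
        contradiction (trans (sym rh) loopless) λ ()

    maxDegree+degree≤ : adj H r r ≡ false → Fin (n G) → maxDegree G + degree H r ≤ k
    maxDegree+degree≤ loopless x₀ =
      let x , Δ≡dx = maxDegree-attained G x₀ in
      subst (λ Δ → Δ + degree H r ≤ k) (sym Δ≡dx) (degree+degree≤ loopless x)

module RootedColoring (G H : Graph) (r : Fin (n H)) (loopless : adj H r r ≡ false)
  {kG kH M : ℕ} (f : Fin (n G) → Fin kG) (g : Fin (n H) → Fin kH)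
  (f-inj : IsInjectiveColoring G kG f) (g-inj : IsInjectiveColoring H kH g)
  (kG≤M : kG ≤ M) (kH≤M : kH ≤ M) (Δ+d≤M : maxDegree G + degree H r ≤ M) where

  open RootedProduct G H r

  rootColor : Fin (n G) → Fin (suc M)
  rootColor i = inject≤ (f i) (m≤n⇒m≤1+n kG≤M)

  rootNeighbourColors : Fin kH → Bool
  rootNeighbourColors = image (adj H r) g

  forbidden : Fin (n G) → Fin (suc M) → Bool
  forbidden i = ⁅ rootColor i ⁆ ∪ image (adj G i) rootColor

  count-forbidden≤ : (i : Fin (n G)) → count (forbidden i) ≤ suc (maxDegree G)
  count-forbidden≤ i = begin
    count (forbidden i)                                        ≤⟨ count-∪ ⁅ rootColor i ⁆ (image (adj G i) rootColor) ⟩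
    count ⁅ rootColor i ⁆ + count (image (adj G i) rootColor)  ≤⟨ +-mono-≤ (≤-reflexive (count-⁅⁆ (rootColor i)))
                                                                           (count-image-≤ (adj G i) rootColor) ⟩
    suc (count (adj G i))                                      ≡⟨ cong suc (degree≡count G i) ⟨
    suc (degree G i)                                           ≤⟨ s≤s (degree≤maxDegree G i) ⟩
    suc (maxDegree G)                                          ∎
    where open ≤-Reasoning

  count-rootNeighbourColors≤ : (i : Fin (n G)) → count rootNeighbourColors ≤ count (∁ (forbidden i))
  count-rootNeighbourColors≤ i = +-cancelˡ-≤ (maxDegree G) _ _ (begin
    maxDegree G + count rootNeighbourColors  ≤⟨ +-monoʳ-≤ (maxDegree G) rootNeighbourColors≤degree ⟩
    maxDegree G + degree H r                 ≤⟨ Δ+d≤M ⟩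
    M                                        ≤⟨ s≤s⁻¹ 1+M≤ ⟩
    maxDegree G + count (∁ (forbidden i))    ∎)
    where
    open ≤-Reasoning
    rootNeighbourColors≤degree : count rootNeighbourColors ≤ degree H r
    rootNeighbourColors≤degree =
      subst (count rootNeighbourColors ≤_) (sym (degree≡count H r)) (count-image-≤ (adj H r) g)
    1+M≤ : suc M ≤ suc (maxDegree G) + count (∁ (forbidden i))
    1+M≤ = subst (_≤ suc (maxDegree G) + count (∁ (forbidden i))) (count-complement (forbidden i))
                 (+-monoˡ-≤ _ (count-forbidden≤ i))

  recolor : (i : Fin (n G)) → RespectfulInjection rootNeighbourColors (∁ (forbidden i)) (∁ ⁅ rootColor i ⁆)
  recolor i = respectfulInjection (∁-anti (p⊆p∪q _)) (count-rootNeighbourColors≤ i)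
                                  (subst (kH ≤_) (sym (count-∁⁅⁆ (rootColor i))) kH≤M)

  σ : Fin (n G) → Fin kH → Fin (suc M)
  σ i = RespectfulInjection.σ (recolor i)

  σ≢rootColor : (i : Fin (n G)) (c : Fin kH) → σ i c ≢ rootColor i
  σ≢rootColor i c = ∁⁅⁆⇒≢ (RespectfulInjection.into (recolor i) c)

  copyColor : Fin (n G) → Fin (n H) → Fin (suc M)
  copyColor i h with h ≟ r
  ... | yes _ = rootColor i
  ... | no  _ = σ i (g h)

  copyColor-root : (i : Fin (n G)) → copyColor i r ≡ rootColor i
  copyColor-root i with r ≟ r
  ... | yes _  = refl
  ... | no r≢r = contradiction refl r≢r

  copyColor-nonroot : {i : Fin (n G)} {h : Fin (n H)} → h ≢ r → copyColor i h ≡ σ i (g h)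
  copyColor-nonroot {i} {h} h≢r with h ≟ r
  ... | yes h≡r = contradiction h≡r h≢r
  ... | no  _   = refl

  copyColor-injective : (i : Fin (n G)) → IsInjectiveColoring H (suc M) (copyColor i)
  copyColor-injective i x u w xu xw eq with u ≟ r | w ≟ r
  ... | yes u≡r | yes w≡r = trans u≡r (sym w≡r)
  ... | yes _   | no  _   = contradiction (sym eq) (σ≢rootColor i (g w))
  ... | no  _   | yes _   = contradiction eq (σ≢rootColor i (g u))
  ... | no  _   | no  _   = g-inj x u w xu xw (RespectfulInjection.injective (recolor i) eq)

  rootNeighbour-apart : {i j : Fin (n G)} {h : Fin (n H)} → adj G i j ≡ true → adj H r h ≡ true →
                        copyColor i h ≢ rootColor j
  rootNeighbour-apart {i} {j} {h} ij rh eq = contradiction (trans (cong not (sym hit)) free) λ ()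
    where
    h≢r : h ≢ r
    h≢r refl with () ← trans (sym rh) loopless
    free : ∁ (forbidden i) (σ i (g h)) ≡ true
    free = RespectfulInjection.respects (recolor i) (g h) (image⁺ g rh)
    hit : forbidden i (σ i (g h)) ≡ true
    hit = subst (λ y → forbidden i y ≡ true) (trans (sym eq) (copyColor-nonroot h≢r))
                (q⊆p∪q ⁅ rootColor i ⁆ {q = image (adj G i) rootColor} (rootColor j)
                       (image⁺ {p = adj G i} rootColor ij))

  color : Vertex → Fin (suc M)
  color (i , h) = copyColor i h

  color-injective : IsInjectiveColoringᴱ (suc M) color
  color-injective (inCopy xu)     (inCopy xw)      eq = cong (_ ,_) (copyColor-injective _ _ _ _ xu xw eq)
  color-injective (inCopy rh)     (alongRoots ij)  eq =
    contradiction (trans eq (copyColor-root _)) (rootNeighbour-apart ij rh)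
  color-injective (alongRoots ij) (inCopy rh)      eq =
    contradiction (trans (sym eq) (copyColor-root _)) (rootNeighbour-apart ij rh)
  color-injective (alongRoots ij) (alongRoots ij′) eq = cong (_, r) (f-inj _ _ _ ij ij′
    (inject≤-injective _ _ _ _ (trans (sym (copyColor-root _)) (trans eq (copyColor-root _)))))

  rootedProductColoring : HasInjectiveColoring (rootedProduct G H r) (suc M)
  rootedProductColoring = color ∘ remQuot (n H) , fromPairs color-injective

injChromaticNumber-empty : {adj₀ : Fin 0 → Fin 0 → Bool} {k : ℕ} → InjChromaticNumber (mkGraph 0 adj₀) k → k ≡ 0
injChromaticNumber-empty (_ , minimal) = n≤0⇒n≡0 (minimal 0 ((λ ()) , λ ()))

≤-≤1+⇒≡⊎≡+1 : {m k : ℕ} → m ≤ k → k ≤ suc m → k ≡ m ⊎ k ≡ m + 1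
≤-≤1+⇒≡⊎≡+1 {m} m≤k k≤1+m with m≤n⇒m<n∨m≡n m≤k
... | inj₁ m<k = inj₂ (trans (≤-antisym k≤1+m m<k) (+-comm 1 m))
... | inj₂ m≡k = inj₁ (sym m≡k)

∈-candidates : {a b c k : ℕ} → a ⊔ b ⊔ c ≤ k → k ≤ suc (a ⊔ b ⊔ c) →
               k ∈ (a ∷ b ∷ a + 1 ∷ b + 1 ∷ c ∷ c + 1 ∷ [])
∈-candidates {a} {b} {c} M≤k k≤1+M with ≤-≤1+⇒≡⊎≡+1 M≤k k≤1+M | ⊔-sel (a ⊔ b) c | ⊔-sel a b
... | inj₁ refl | inj₁ M≡a⊔b | inj₁ a⊔b≡a rewrite M≡a⊔b | a⊔b≡a = here refl
... | inj₁ refl | inj₁ M≡a⊔b | inj₂ a⊔b≡b rewrite M≡a⊔b | a⊔b≡b = there (here refl)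
... | inj₂ refl | inj₁ M≡a⊔b | inj₁ a⊔b≡a rewrite M≡a⊔b | a⊔b≡a = there (there (here refl))
... | inj₂ refl | inj₁ M≡a⊔b | inj₂ a⊔b≡b rewrite M≡a⊔b | a⊔b≡b = there (there (there (here refl)))
... | inj₁ refl | inj₂ M≡c    | _          rewrite M≡c = there (there (there (there (here refl))))
... | inj₂ refl | inj₂ M≡c    | _          rewrite M≡c = there (there (there (there (there (here refl)))))

theorem4p6 : (G H : Graph) (r : Fin (n H)) → IsSimple G → IsSimple H →
    (kG kH kP : ℕ) → InjChromaticNumber G kG → InjChromaticNumber H kH →
    InjChromaticNumber (rootedProduct G H r) kP →
    kP ∈ (kG ∷ kH ∷ kG + 1 ∷ kH + 1 ∷ maxDegree G + degree H r ∷ maxDegree G + degree H r + 1 ∷ [])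
theorem4p6 (mkGraph zero _) H r _ _ kG kH kP χG _ χP =
  here (trans (injChromaticNumber-empty χP) (sym (injChromaticNumber-empty χG)))
theorem4p6 G@(mkGraph (suc _) _) H r _ (_ , loopless) kG kH kP
           ((f , f-inj) , minG) ((g , g-inj) , minH) ((c , c-inj) , minP) =
  ∈-candidates lower upper
  where
  open RootedProduct G H r
  M : ℕ
  M = kG ⊔ kH ⊔ (maxDegree G + degree H r)
  pairs : IsInjectiveColoringᴱ kP (c ∘ uncurry combine)
  pairs = toPairs c-inj
  lower : M ≤ kP
  lower = ⊔-lub (⊔-lub (minG kP (_ , restrictToRoots pairs)) (minH kP (_ , restrictToCopy pairs zero)))
                (maxDegree+degree≤ pairs (loopless r) zero)
  upper : kP ≤ suc M
  upper = minP (suc M) (RootedColoring.rootedProductColoring G H r (loopless r) f g f-inj g-inj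
            (≤-trans (m≤m⊔n kG kH) (m≤m⊔n _ _)) (≤-trans (m≤n⊔m kG kH) (m≤m⊔n _ _)) (m≤n⊔m _ _))
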